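{- Let $q$ be a power of an odd prime, let $\lambda\in\mathbb{F}_q$ be a non-square, and let $a\in\mathbb{F}_q$ with $a\neq 1/4$. Then the (weakly) connected component of $\mathcal{G}(\lambda,X^2+X+a)$ containing the vertex $0$ does not have a Hamiltonian cycle.
   Context: For a polynomial $f\in\mathbb{F}_q[X]$ and a non-square $\lambda\in\mathbb{F}_q$, $\mathcal{G}(\lambda,f)$ is the directed graph with vertex set $\mathbb{F}_q$ and an edge from $x$ to $y$ iff $(y^2-f(x))(\lambda y^2-f(x))=0$ (loops allowed). A Hamiltonian cycle of a component is a directed cycle passing through every vertex of the component exactly once. -}

module Defs where

open import Level using (0ℓ)
open import Data.Product using (Σ; ∃; _×_; _,_)
open import Data.List using (List; []; _∷_)
open import Data.List.Membership.Propositional using (_∈_)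
open import Data.List.Relation.Unary.Unique.Propositional using (Unique)
open import Data.Empty using (⊥)
open import Relation.Nullary using (¬_)
open import Relation.Binary.PropositionalEquality using (_≡_; _≢_)
open import Relation.Binary.Definitions using (DecidableEquality)
open import Algebra.Structures using (IsCommutativeRing)
open import Function.Bundles using (_⇔_)

record FiniteOddField : Set₁ where
  infixl 6 _+_ _-_
  infixl 7 _*_
  field
    F    : Set
    _+_  : F → F → F
    _*_  : F → F → F
    -_   : F → F
    0#   : F
    1#   : F
    _⁻¹  : F → F
    isCommutativeRing : IsCommutativeRing _≡_ _+_ _*_ -_ 0# 1#
    0≢1     : 0# ≢ 1#
    ⁻¹-inverse : ∀ x → x ≢ 0# → x * (x ⁻¹) ≡ 1#
    1+1≢0   : 1# + 1# ≢ 0#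
    _≟_     : DecidableEquality F
    elements : List F
    complete : ∀ x → x ∈ elements

  _-_ : F → F → F
  x - y = x + (- y)

  IsSquare : F → Set
  IsSquare z = ∃ λ t → t * t ≡ z

  quarter : F
  quarter = (1# + 1# + 1# + 1#) ⁻¹

module Graph {V : Set} (E : V → V → Set) where

  data WConn (x : V) : V → Set where
    here : WConn x x
    fwd  : ∀ {y z} → WConn x y → E y z → WConn x z
    bwd  : ∀ {y z} → WConn x y → E z y → WConn x z

  closesFrom : V → V → List V → Set
  closesFrom s c []       = E c s
  closesFrom s c (y ∷ ys) = E c y × closesFrom s y ys

  IsCycle : List V → Set
  IsCycle []       = ⊥
  IsCycle (v ∷ vs) = closesFrom v v vs

  HasHamiltonianCycleOfComponent : V → Set
  HasHamiltonianCycleOfComponent x₀ =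
    Σ (List V) λ cyc → IsCycle cyc × Unique cyc × (∀ x → (x ∈ cyc) ⇔ WConn x₀ x)

module _ (K : FiniteOddField) where
  open FiniteOddField K

  GEdge : F → (F → F) → F → F → Set
  GEdge λ' f x y = ((y * y) - f x) * ((λ' * (y * y)) - f x) ≡ 0#

  quadPoly : F → F → F
  quadPoly a x = x * x + x + a

module Submission where

-- Every edge into 0 starts at a root of f = X² + X + a, and a root r of f has 0 as its only
-- out-neighbour: y² = f(r) = 0 or λy² = 0 forces y = 0 because λ ≠ 0. On a Hamiltonian cycle
-- of the component of 0, the predecessor of 0 is such a root r; then −1−r is a root as well,
-- distinct from r since a ≠ 1/4. Both roots send an edge to 0, so both lie in the component,
-- hence on the cycle, and both have successor 0 there, contradicting that 0 is visited once.

open import Defs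
open import Level using (0ℓ)
open import Data.Empty using (⊥; ⊥-elim)
open import Data.Sum using (_⊎_; inj₁; inj₂; reduce)
open import Data.Product using (∃-syntax; _×_; _,_)
open import Data.List using ([]; _∷_; _++_; [_])
open import Data.List.Membership.Propositional using (_∈_)
open import Data.List.Relation.Unary.Any using (here; there)
open import Data.List.Relation.Unary.All using (lookup)
open import Data.List.Relation.Unary.AllPairs using (_∷_)
open import Data.List.Relation.Unary.Unique.Propositional using (Unique)
import Data.List.Relation.Binary.Permutation.Setoid.Properties as Permutation
open import Function.Bundles using (Equivalence)
open import Relation.Nullary using (¬_; yes; no)
open import Relation.Binary.PropositionalEquality
  using (_≡_; _≢_; refl; sym; trans; cong; setoid; module ≡-Reasoning)
open import Algebra.Bundles using (CommutativeRing)
import Algebra.Properties.Ring as RingProperties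
import Algebra.Solver.Ring.NaturalCoefficients.Default as SemiringSolver

module HamiltonianCycles {V : Set} (E : V → V → Set) where
  open Graph E
  open Permutation (setoid V) using (∷↭∷ʳ; ∈-resp-↭; Unique-resp-↭)

  LeadsOnlyTo : V → V → Set
  LeadsOnlyTo x z = ∀ {y} → E x y → y ≡ z

  closesFrom-predecessor : ∀ {s c} vs → closesFrom s c vs →
                           ∀ {z} → z ∈ vs ++ [ s ] → ∃[ x ] x ∈ c ∷ vs × E x z
  closesFrom-predecessor []       c→s       (here refl) = _ , here refl , c→s
  closesFrom-predecessor (y ∷ ys) (c→y , _) (here refl) = _ , here refl , c→y
  closesFrom-predecessor (y ∷ ys) (_ , y↝s) (there z∈)  with closesFrom-predecessor ys y↝s z∈
  ... | x , x∈ , x→z = x , there x∈ , x→z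

  closesFrom-successor : ∀ {s c} vs → closesFrom s c vs →
                         ∀ {x z} → x ∈ c ∷ vs → LeadsOnlyTo x z → z ∈ vs ++ [ s ]
  closesFrom-successor []       c→s       (here refl) x↠z = here (sym (x↠z c→s))
  closesFrom-successor (y ∷ ys) (c→y , _) (here refl) x↠z = here (sym (x↠z c→y))
  closesFrom-successor (y ∷ ys) (_ , y↝s) (there x∈)  x↠z = there (closesFrom-successor ys y↝s x∈ x↠z)

  closesFrom-LeadsOnlyTo-injective :
    ∀ {s c} vs → closesFrom s c vs → Unique (vs ++ [ s ]) →
    ∀ {x x′ z} → x ∈ c ∷ vs → x′ ∈ c ∷ vs → LeadsOnlyTo x z → LeadsOnlyTo x′ z → x ≡ x′
  closesFrom-LeadsOnlyTo-injective []       _           _        (here refl) (here refl) _   _    = refl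
  closesFrom-LeadsOnlyTo-injective (y ∷ ys) _           _        (here refl) (here refl) _   _    = refl
  closesFrom-LeadsOnlyTo-injective (y ∷ ys) (c→y , y↝s) (y∉ ∷ _) (here refl) (there x′∈) x↠z x′↠z =
    ⊥-elim (lookup y∉ (closesFrom-successor ys y↝s x′∈ x′↠z) (x↠z c→y))
  closesFrom-LeadsOnlyTo-injective (y ∷ ys) (c→y , y↝s) (y∉ ∷ _) (there x∈)  (here refl) x↠z x′↠z =
    ⊥-elim (lookup y∉ (closesFrom-successor ys y↝s x∈ x↠z) (x′↠z c→y))
  closesFrom-LeadsOnlyTo-injective (y ∷ ys) (_ , y↝s)   (_ ∷ u)  (there x∈)  (there x′∈) x↠z x′↠z =
    closesFrom-LeadsOnlyTo-injective ys y↝s u x∈ x′∈ x↠z x′↠z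

  IsCycle-predecessor : ∀ {cyc} → IsCycle cyc → ∀ {z} → z ∈ cyc → ∃[ x ] x ∈ cyc × E x z
  IsCycle-predecessor {v ∷ vs} cl z∈ = closesFrom-predecessor vs cl (∈-resp-↭ (∷↭∷ʳ v vs) z∈)

  IsCycle-LeadsOnlyTo-injective : ∀ {cyc} → IsCycle cyc → Unique cyc →
    ∀ {x x′ z} → x ∈ cyc → x′ ∈ cyc → LeadsOnlyTo x z → LeadsOnlyTo x′ z → x ≡ x′
  IsCycle-LeadsOnlyTo-injective {v ∷ vs} cl u =
    closesFrom-LeadsOnlyTo-injective vs cl (Unique-resp-↭ (∷↭∷ʳ v vs) u)

  ¬HamiltonianCycle-twinFunnels :
    ∀ {z} → (∀ {x} → E x z → LeadsOnlyTo x z) → (∀ {x} → E x z → ∃[ x′ ] x′ ≢ x × E x′ z) →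
    ¬ HasHamiltonianCycleOfComponent z
  ¬HamiltonianCycle-twinFunnels {z} funnel twin (cyc , cl , u , cyc⇔comp) =
    refute (IsCycle-predecessor cl (onCycle here))
    where
    onCycle : ∀ {y} → WConn z y → y ∈ cyc
    onCycle {y} = Equivalence.from (cyc⇔comp y)

    refute : ∃[ x ] x ∈ cyc × E x z → ⊥
    refute (x , x∈ , x→z) =
      let x′ , x′≢x , x′→z = twin x→z
      in x′≢x (IsCycle-LeadsOnlyTo-injective cl u (onCycle (bwd here x′→z)) x∈ (funnel x′→z) (funnel x→z))

module FieldFacts (K : FiniteOddField) where
  open FiniteOddField K

  commutativeRing : CommutativeRing 0ℓ 0ℓ
  commutativeRing = record { isCommutativeRing = isCommutativeRing }

  open CommutativeRing commutativeRing
    using (ring; commutativeSemiring; +-identityˡ; +-identityʳ; +-assoc; -‿inverseˡ; -‿inverseʳ;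
           *-identityˡ; *-identityʳ; *-assoc; *-comm; zeroˡ; zeroʳ)
  open RingProperties ring
    using (-‿distribˡ-*; -‿distribʳ-*; -‿involutive)
    renaming (x∙y⁻¹≈ε⇒x≈y to x-y≡0⇒x≡y; x≈y⇒x∙y⁻¹≈ε to x≡y⇒x-y≡0)
  open SemiringSolver commutativeSemiring using (solve; _:=_; _:+_; _:*_; con)
  open ≡-Reasoning

  4# : F
  4# = 1# + 1# + 1# + 1#

  x≢0⇒y≡x⁻¹*[x*y] : ∀ {x} → x ≢ 0# → ∀ y → y ≡ x ⁻¹ * (x * y)
  x≢0⇒y≡x⁻¹*[x*y] {x} x≢0 y = begin
    y                ≡⟨ sym (*-identityˡ y) ⟩
    1# * y           ≡⟨ cong (_* y) (sym (trans (*-comm (x ⁻¹) x) (⁻¹-inverse x x≢0))) ⟩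
    (x ⁻¹ * x) * y   ≡⟨ *-assoc (x ⁻¹) x y ⟩
    x ⁻¹ * (x * y)   ∎

  x*y≡0⇒x≡0⊎y≡0 : ∀ {x y} → x * y ≡ 0# → x ≡ 0# ⊎ y ≡ 0#
  x*y≡0⇒x≡0⊎y≡0 {x} {y} xy≡0 with x ≟ 0#
  ... | yes x≡0 = inj₁ x≡0
  ... | no  x≢0 = inj₂ (trans (x≢0⇒y≡x⁻¹*[x*y] x≢0 y) (trans (cong (x ⁻¹ *_) xy≡0) (zeroʳ (x ⁻¹))))

  x*x≡0⇒x≡0 : ∀ {x} → x * x ≡ 0# → x ≡ 0#
  x*x≡0⇒x≡0 xx≡0 = reduce (x*y≡0⇒x≡0⊎y≡0 xx≡0)

  x*y≡1⇒y≡x⁻¹ : ∀ {x y} → x * y ≡ 1# → y ≡ x ⁻¹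
  x*y≡1⇒y≡x⁻¹ {x} {y} xy≡1 = begin
    y               ≡⟨ x≢0⇒y≡x⁻¹*[x*y] x≢0 y ⟩
    x ⁻¹ * (x * y)  ≡⟨ cong (x ⁻¹ *_) xy≡1 ⟩
    x ⁻¹ * 1#       ≡⟨ *-identityʳ (x ⁻¹) ⟩
    x ⁻¹            ∎
    where
    x≢0 : x ≢ 0#
    x≢0 refl = 0≢1 (trans (sym (zeroˡ y)) xy≡1)

  nonSquare⇒≢0 : ∀ {x} → ¬ IsSquare x → x ≢ 0#
  nonSquare⇒≢0 ¬sq refl = ¬sq (0# , zeroˡ 0#)

  -x*-x≡x*x : ∀ x → - x * - x ≡ x * x
  -x*-x≡x*x x = begin
    - x * - x      ≡⟨ sym (-‿distribˡ-* x (- x)) ⟩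
    - (x * - x)    ≡⟨ cong -_ (sym (-‿distribʳ-* x x)) ⟩
    - (- (x * x))  ≡⟨ -‿involutive (x * x) ⟩
    x * x          ∎

  module _ (λ' : F) (f : F → F) where

    GEdge-into-0⇒root : ∀ {x} → GEdge K λ' f x 0# → f x ≡ 0#
    GEdge-into-0⇒root {x} e with x*y≡0⇒x≡0⊎y≡0 e
    ... | inj₁ 0²-fx≡0  = trans (sym (x-y≡0⇒x≡y _ _ 0²-fx≡0)) (zeroˡ 0#)
    ... | inj₂ λ0²-fx≡0 = trans (sym (x-y≡0⇒x≡y _ _ λ0²-fx≡0)) (trans (cong (λ' *_) (zeroˡ 0#)) (zeroʳ λ'))

    root⇒GEdge-into-0 : ∀ {x} → f x ≡ 0# → GEdge K λ' f x 0#
    root⇒GEdge-into-0 {x} fx≡0 =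
      trans (cong (_* ((λ' * (0# * 0#)) - f x)) (x≡y⇒x-y≡0 (trans (zeroˡ 0#) (sym fx≡0)))) (zeroˡ _)

    root-LeadsOnlyTo-0 : λ' ≢ 0# → ∀ {x y} → f x ≡ 0# → GEdge K λ' f x y → y ≡ 0#
    root-LeadsOnlyTo-0 λ≢0 fx≡0 e with x*y≡0⇒x≡0⊎y≡0 e
    ... | inj₁ y²-fx≡0 = x*x≡0⇒x≡0 (trans (x-y≡0⇒x≡y _ _ y²-fx≡0) fx≡0)
    ... | inj₂ λy²-fx≡0 with x*y≡0⇒x≡0⊎y≡0 (trans (x-y≡0⇒x≡y _ _ λy²-fx≡0) fx≡0)
    ...   | inj₁ λ≡0  = ⊥-elim (λ≢0 λ≡0)
    ...   | inj₂ y²≡0 = x*x≡0⇒x≡0 y²≡0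

  quadPoly-reflect : ∀ a x → quadPoly K a (- (x + 1#)) ≡ quadPoly K a x
  quadPoly-reflect a x = begin
    - u * - u + - u + a        ≡⟨ cong (λ t → t + - u + a) (-x*-x≡x*x u) ⟩
    u * u + - u + a            ≡⟨ cong (_+ a) (expand x (- u)) ⟩
    x * x + x + (u + - u) + a  ≡⟨ cong (λ t → x * x + x + t + a) (-‿inverseʳ u) ⟩
    x * x + x + 0# + a         ≡⟨ cong (_+ a) (+-identityʳ (x * x + x)) ⟩
    x * x + x + a              ∎
    where
    u = x + 1#
    expand : ∀ x y → (x + 1#) * (x + 1#) + y ≡ x * x + x + ((x + 1#) + y)
    expand = solve 2 (λ x y → (x :+ con 1) :* (x :+ con 1) :+ y := x :* x :+ x :+ ((x :+ con 1) :+ y)) refl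

  -- 4(x² + x + a) = (2x + 1)² + 4a − 1, with the 1 moved across so that it is a semiring identity.
  completeSquare : ∀ a x → 4# * quadPoly K a x + 1# ≡ (x + x + 1#) * (x + x + 1#) + 4# * a
  completeSquare = solve 2
    (λ a x → con 4 :* (x :* x :+ x :+ a) :+ con 1 := (x :+ x :+ con 1) :* (x :+ x :+ con 1) :+ con 4 :* a)
    refl

  quadPoly-double-root : ∀ {a x} → quadPoly K a x ≡ 0# → - (x + 1#) ≡ x → a ≡ quarter
  quadPoly-double-root {a} {x} fx≡0 x′≡x = x*y≡1⇒y≡x⁻¹ (sym (begin
    1#                       ≡⟨ sym (+-identityˡ 1#) ⟩
    0# + 1#                  ≡⟨ cong (_+ 1#) (sym (zeroʳ 4#)) ⟩
    4# * 0# + 1#             ≡⟨ cong (λ t → 4# * t + 1#) (sym fx≡0) ⟩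
    4# * quadPoly K a x + 1# ≡⟨ completeSquare a x ⟩
    s * s + 4# * a           ≡⟨ cong (λ t → t * t + 4# * a) s≡0 ⟩
    0# * 0# + 4# * a         ≡⟨ cong (_+ 4# * a) (zeroˡ 0#) ⟩
    0# + 4# * a              ≡⟨ +-identityˡ (4# * a) ⟩
    4# * a                   ∎))
    where
    s = x + x + 1#
    s≡0 : s ≡ 0#
    s≡0 = begin
      x + x + 1#              ≡⟨ +-assoc x x 1# ⟩
      x + (x + 1#)            ≡⟨ cong (_+ (x + 1#)) (sym x′≡x) ⟩
      - (x + 1#) + (x + 1#)   ≡⟨ -‿inverseˡ (x + 1#) ⟩
      0#                      ∎

proposition5p5 : (K : FiniteOddField) → (λ' a : FiniteOddField.F K) →
    ¬ FiniteOddField.IsSquare K λ' → a ≢ FiniteOddField.quarter K →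
    ¬ Graph.HasHamiltonianCycleOfComponent (GEdge K λ' (quadPoly K a)) (FiniteOddField.0# K)
proposition5p5 K λ' a λ-nonSquare a≢quarter = ¬HamiltonianCycle-twinFunnels funnel twin
  where
  open FiniteOddField K
  open FieldFacts K

  f : F → F
  f = quadPoly K a

  open HamiltonianCycles (GEdge K λ' f)

  funnel : ∀ {x} → GEdge K λ' f x 0# → LeadsOnlyTo x 0#
  funnel x→0 = root-LeadsOnlyTo-0 λ' f (nonSquare⇒≢0 λ-nonSquare) (GEdge-into-0⇒root λ' f x→0)

  twin : ∀ {x} → GEdge K λ' f x 0# → ∃[ x′ ] x′ ≢ x × GEdge K λ' f x′ 0#
  twin {x} x→0 = - (x + 1#)
               , (λ x′≡x → a≢quarter (quadPoly-double-root fx≡0 x′≡x))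
               , root⇒GEdge-into-0 λ' f (trans (quadPoly-reflect a x) fx≡0)
    where
    fx≡0 : f x ≡ 0#
    fx≡0 = GEdge-into-0⇒root λ' f x→0
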